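{- Let $n\geq 3$ and let $a=(a_1,\dots,a_n)$ be positive integers with $a_1\geq\dots\geq a_n$ and $\prod_{i=1}^n a_i\leq\sum_{i=1}^n a_i$. For $2\leq m\leq n$, let $k_{\star,m}$ be the greatest index $k$ with $a_k\geq m$ (and $k_{\star,m}=0$ if there is none). Then $k_{\star,m}<\log_m(n)+1$. -}

module Defs where

open import Data.Nat using (ℕ; zero; suc; _≤ᵇ_)
open import Data.Fin using (Fin; toℕ; fromℕ; inject₁)
open import Data.Bool using (if_then_else_)

-- Here a : Fin n → ℕ, with a_k = a (k-1) (0-based Fin).
kstar : (n : ℕ) → (Fin n → ℕ) → ℕ → ℕ
kstar zero    a m = 0
kstar (suc n) a m =
  if m ≤ᵇ a (fromℕ n) then suc n else kstar n (λ i → a (inject₁ i)) m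

-- If k = k⋆ ≥ 1 then a₁,…,a_k ≥ m, and together with aᵢ ≥ 1 this gives
-- a₁·m^(k-1) ≤ ∏ a ≤ ∑ a ≤ n·a₁, so m^(k-1) ≤ n.  When k < n the last step
-- is strict, because a_n < m ≤ a₁.  When k = n we would get m^(n-1) ≤ n,
-- which fails for m ≥ 2 and n ≥ 3.
module Submission where

open import Defs
open import Data.Nat using (ℕ; _≤_; _<_; _^_; _+_; _*_; zero; suc; z≤n; s≤s; s≤s⁻¹; _≤ᵇ_; >-nonZero)
open import Data.Nat.Properties
open import Data.Fin using (Fin; toℕ; fromℕ; inject₁)
  renaming (_≤_ to _≤ᶠ_; zero to fzero; suc to fsuc)
open import Data.Vec.Functional using (foldr; head; tail)
open import Data.Fin.Properties using (toℕ-fromℕ; toℕ-inject₁)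
open import Data.Bool using (true; false; T)
open import Data.Product using (Σ-syntax; _×_; _,_)
open import Data.Sum using ([_,_]′)
open import Relation.Nullary using (contradiction)
open import Relation.Binary.PropositionalEquality
open import Function using (_∘_)

sum product : ∀ {n} → (Fin n → ℕ) → ℕ
sum     = foldr _+_ 0
product = foldr _*_ 1

sum-≤-* : ∀ n (b : Fin n → ℕ) x → (∀ i → b i ≤ x) → sum b ≤ n * x
sum-≤-* zero    b x b≤x = z≤n
sum-≤-* (suc n) b x b≤x = +-mono-≤ (b≤x fzero) (sum-≤-* n (tail b) x (b≤x ∘ fsuc))

sum-<-* : ∀ n (b : Fin n → ℕ) x → (∀ i → b i ≤ x) → (j : Fin n) → b j < x → sum b < n * x
sum-<-* (suc n) b x b≤x fzero    bj<x = +-mono-<-≤ bj<x (sum-≤-* n (tail b) x (b≤x ∘ fsuc))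
sum-<-* (suc n) b x b≤x (fsuc j) bj<x = +-mono-≤-< (b≤x fzero) (sum-<-* n (tail b) x (b≤x ∘ fsuc) j bj<x)

1≤product : ∀ n (b : Fin n → ℕ) → (∀ i → 1 ≤ b i) → 1 ≤ product b
1≤product zero    b 1≤b = ≤-refl
1≤product (suc n) b 1≤b = *-mono-≤ (1≤b fzero) (1≤product n (tail b) (1≤b ∘ fsuc))

^≤product : ∀ n (b : Fin n → ℕ) m k → k ≤ n → (∀ i → 1 ≤ b i) →
            (∀ i → toℕ i < k → m ≤ b i) → m ^ k ≤ product b
^≤product n       b m zero    _         1≤b _   = 1≤product n b 1≤b
^≤product (suc n) b m (suc k) (s≤s k≤n) 1≤b m≤b =
  *-mono-≤ (m≤b fzero (s≤s z≤n))
           (^≤product n (tail b) m k k≤n (1≤b ∘ fsuc) (λ i i<k → m≤b (fsuc i) (s≤s i<k)))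

suc-<-^ : ∀ m n → 2 ≤ m → 2 ≤ n → suc n < m ^ n
suc-<-^ m (suc zero)          _   (s≤s ())
suc-<-^ m (suc (suc zero))    2≤m _ = *-mono-≤ 2≤m (*-mono-≤ 2≤m ≤-refl)
suc-<-^ m (suc n@(suc (suc _))) 2≤m _ = begin-strict
  suc (suc n)   <⟨ +-mono-≤ (m^n>0 m n) (suc-<-^ m n 2≤m (s≤s (s≤s z≤n))) ⟩
  m ^ n + m ^ n ≡⟨ cong (m ^ n +_) (sym (+-identityʳ (m ^ n))) ⟩
  2 * m ^ n     ≤⟨ *-monoˡ-≤ (m ^ n) 2≤m ⟩
  m ^ suc n     ∎
  where
    open ≤-Reasoning
    instance _ = >-nonZero (≤-trans (s≤s z≤n) 2≤m)

kstar≤n : ∀ n (a : Fin n → ℕ) m → kstar n a m ≤ n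
kstar≤n zero    a m = z≤n
kstar≤n (suc n) a m with m ≤ᵇ a (fromℕ n)
... | true  = ≤-refl
... | false = m≤n⇒m≤1+n (kstar≤n n (a ∘ inject₁) m)

kstar-witness : ∀ n (a : Fin n → ℕ) m k → kstar n a m ≡ suc k →
                Σ[ i ∈ Fin n ] toℕ i ≡ k × m ≤ a i
kstar-witness (suc n) a m k kstar≡ with m ≤ᵇ a (fromℕ n) in test
... | true  = fromℕ n , trans (toℕ-fromℕ n) (suc-injective kstar≡)
                      , ≤ᵇ⇒≤ m _ (subst T (sym test) _)
... | false with kstar-witness n (a ∘ inject₁) m k kstar≡
...   | i , i≡k , m≤ai = inject₁ i , trans (toℕ-inject₁ i) i≡k , m≤ai

kstar<n⇒last<m : ∀ n (a : Fin (suc n) → ℕ) m → kstar (suc n) a m < suc n → a (fromℕ n) < m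
kstar<n⇒last<m n a m kstar<n with m ≤ᵇ a (fromℕ n) in test
... | true  = contradiction kstar<n (<-irrefl refl)
... | false = ≰⇒> λ m≤last → subst T test (≤⇒≤ᵇ m≤last)

m≤a-below-kstar : ∀ n (a : Fin n → ℕ) → (∀ i j → i ≤ᶠ j → a j ≤ a i) →
                  ∀ m k → kstar n a m ≡ suc k → ∀ j → toℕ j ≤ k → m ≤ a j
m≤a-below-kstar n a antitone m k kstar≡ j j≤k with kstar-witness n a m k kstar≡
... | i , i≡k , m≤ai = ≤-trans m≤ai (antitone j i (subst (toℕ j ≤_) (sym i≡k) j≤k))

^*head≤product : ∀ n (a : Fin (suc n) → ℕ) m k → k ≤ n → (∀ i → 1 ≤ a i) →
                 (∀ j → toℕ j ≤ k → m ≤ a j) → m ^ k * head a ≤ product a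
^*head≤product n a m k k≤n 1≤a m≤a = begin
  m ^ k * head a          ≡⟨ *-comm (m ^ k) (head a) ⟩
  head a * m ^ k          ≤⟨ *-monoʳ-≤ (head a) (^≤product n (tail a) m k k≤n (1≤a ∘ fsuc) (m≤a ∘ fsuc)) ⟩
  head a * product (tail a) ∎
  where open ≤-Reasoning

^-pred-kstar<n : ∀ n → 3 ≤ n → (a : Fin n → ℕ) →
                 (∀ i → 1 ≤ a i) →
                 (∀ i j → i ≤ᶠ j → a j ≤ a i) →
                 product a ≤ sum a →
                 ∀ m → 2 ≤ m → ∀ k → kstar n a m ≡ suc k → m ^ k < n
^-pred-kstar<n (suc n) 3≤n a 1≤a antitone P≤S m 2≤m k kstar≡ =
  [ k<n⇒^k<n , (λ k≡n → contradiction k≡n k≢n) ]′ (m≤n⇒m<n∨m≡n k≤n)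
  where
    x : ℕ
    x = head a
    k≤n : k ≤ n
    k≤n = s≤s⁻¹ (subst (_≤ suc n) kstar≡ (kstar≤n (suc n) a m))
    m≤a : ∀ j → toℕ j ≤ k → m ≤ a j
    m≤a = m≤a-below-kstar (suc n) a antitone m k kstar≡
    head-max : ∀ j → a j ≤ x
    head-max j = antitone fzero j z≤n
    lower : m ^ k * x ≤ sum a
    lower = ≤-trans (^*head≤product n a m k k≤n 1≤a m≤a) P≤S

    k<n⇒^k<n : k < n → m ^ k < suc n
    k<n⇒^k<n k<n = *-cancelʳ-< x (m ^ k) (suc n)
                     (≤-<-trans lower (sum-<-* (suc n) a x head-max (fromℕ n) last<x))
      where
        last<x : a (fromℕ n) < x
        last<x = <-≤-trans (kstar<n⇒last<m n a m (subst (_< suc n) (sym kstar≡) (s≤s k<n))) (m≤a fzero z≤n)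

    k≢n : k ≢ n
    k≢n refl = <⇒≱ (suc-<-^ m n 2≤m (s≤s⁻¹ 3≤n))
                    (*-cancelʳ-≤ (m ^ n) (suc n) x (≤-trans lower (sum-≤-* (suc n) a x head-max)))
      where instance _ = >-nonZero (≤-trans (≤-trans (s≤s z≤n) 2≤m) (m≤a fzero z≤n))

lemma3p5 : (n : ℕ) → 3 ≤ n → (a : Fin n → ℕ) →
    (∀ i → 1 ≤ a i) →
    (∀ i j → i ≤ᶠ j → a j ≤ a i) →
    foldr _*_ 1 a ≤ foldr _+_ 0 a →
    (m : ℕ) → 2 ≤ m → m ≤ n →
    m ^ kstar n a m < m * n
lemma3p5 n 3≤n a 1≤a antitone P≤S m 2≤m _ with kstar n a m in kstar≡
... | zero  = *-mono-≤ 2≤m (≤-trans (s≤s z≤n) 3≤n)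
... | suc k = *-monoʳ-< m (^-pred-kstar<n n 3≤n a 1≤a antitone P≤S m 2≤m k kstar≡)
  where instance _ = >-nonZero (≤-trans (s≤s z≤n) 2≤m)
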